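{- Assume that every finite union-closed family $\mathcal{G}$ with $\mathcal{G}\notin\{\emptyset,\{\emptyset\}\}$ has an element $x\in U(\mathcal{G})$ with $|\mathcal{G}_x|\ge\frac{|\mathcal{G}|}{2}$. Let $\mathcal{F}$ be a finite union-closed family with $n=|U(\mathcal{F})|$. Then there are sets $S_1\subseteq S_2\subseteq\dots\subseteq S_n\subseteq U(\mathcal{F})$ such that, for every $1\le k\le n$, $|S_k|=k$ and $|\{F\in\mathcal{F}: S_k\subseteq F\}|\ge 2^{ -k}|\mathcal{F}|$. In particular, for every positive integer $k\le n$ there is a $k$-element set $S\subseteq U(\mathcal{F})$ contained in at least $2^{ -k}|\mathcal{F}|$ members of $\mathcal{F}$.
   Context: $U(\mathcal{F})$ is the union of the members of $\mathcal{F}$; $\mathcal{G}_x=\{G\in\mathcal{G}:x\in G\}$. A family is union-closed if the union of any two of its members is a member. -}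

module Defs where

open import Data.Nat using (ℕ; _*_; _^_; _≤_; suc)
open import Data.Fin using (Fin; toℕ)
open import Data.Fin.Subset using (Subset; _∪_; _⊆_; ⋃; ⊥; ∣_∣) renaming (_∈_ to _∈ₛ_)
open import Data.Fin.Subset.Properties using (_∈?_; _⊆?_)
open import Data.List using (List; []; _∷_; length; filter)
open import Data.List.Membership.Propositional using (_∈_)
open import Data.List.Relation.Unary.Unique.Propositional using (Unique)
open import Data.Product using (Σ; _×_; ∃)
open import Relation.Binary.PropositionalEquality using (_≡_)
open import Relation.Nullary using (¬_)

record Family (m : ℕ) : Set where
  constructor family
  field
    members : List (Subset m)
    unique  : Unique members
open Family public

∣_∣ᶠ : ∀ {m} → Family m → ℕ
∣ 𝓖 ∣ᶠ = length (members 𝓖)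

U : ∀ {m} → Family m → Subset m
U 𝓖 = ⋃ (members 𝓖)

UnionClosed : ∀ {m} → Family m → Set
UnionClosed 𝓖 = ∀ A B → A ∈ members 𝓖 → B ∈ members 𝓖 → (A ∪ B) ∈ members 𝓖

∣_at_∣ : ∀ {m} → Family m → Fin m → ℕ
∣ 𝓖 at x ∣ = length (filter (x ∈?_) (members 𝓖))

containing : ∀ {m} → Family m → Subset m → ℕ
containing 𝓕 S = length (filter (S ⊆?_) (members 𝓕))

Nontrivial : ∀ {m} → Family m → Set
Nontrivial 𝓖 = ¬ (members 𝓖 ≡ []) × ¬ (members 𝓖 ≡ ⊥ ∷ [])

FranklConjecture : Set
FranklConjecture = ∀ (m : ℕ) (𝓖 : Family m) → UnionClosed 𝓖 → Nontrivial 𝓖 →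
  ∃ λ (x : Fin m) → x ∈ₛ U 𝓖 × ∣ 𝓖 ∣ᶠ ≤ 2 * ∣ 𝓖 at x ∣

-- Restricting a union-closed family 𝓕 to the members containing S and deleting S
-- from them gives a union-closed family, the link of S, with one member per member
-- of 𝓕 above S.  If S ⊆ U(𝓕) ≠ S, the link contains U(𝓕) ─ S ≠ ∅ (as U(𝓕) ∈ 𝓕),
-- so it is nontrivial and Frankl's conjecture yields x ∉ S lying in at least half
-- of its members; each of these comes from a member of 𝓕 containing S ∪ {x}.
-- Starting from S₀ = ∅ and adding such an x at every step, the number of members
-- of 𝓕 above Sₖ drops by at most a factor 2 per step.
module Submission where

open import Defs
open import Algebra.Properties.CommutativeSemigroup using (x∙yz≈y∙xz)
open import Data.Fin as Fin using (Fin; toℕ)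
open import Data.Fin.Properties using (toℕ<n)
open import Data.Fin.Subset
  using (Subset; _⊆_; _∪_; _─_; ⋃; ⊥; ⁅_⁆; ∣_∣; _∉_; Nonempty; inside; outside)
  renaming (_∈_ to _∈ₛ_)
open import Data.Fin.Subset.Properties
  using ( _∈?_; _⊆?_; nonempty?; ∉⊥; ⊆-refl; ⊆-trans; ⊆-min; ⊆-antisym; p⊆p∪q; q⊆p∪q
        ; x∈p∪q⁻; x∈p∧x∉q⇒x∈p─q; p─q⊆p; x∈⁅y⁆⇒x≡y; ∪-identityʳ; ∣⊥∣≡0
        ; p⊆q⇒∣p∣≤∣q∣)
open import Data.List using (List; []; _∷_; length; filter; map)
open import Data.List.Membership.Propositional using (_∈_)
open import Data.List.Membership.Propositional.Properties
  using (∈-map⁺; ∈-map⁻; ∈-filter⁺; ∈-filter⁻)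
open import Data.List.Properties using (length-map; filter-all)
open import Data.List.Relation.Binary.Sublist.Heterogeneous using (Sublist; []; _∷_; _∷ʳ_)
open import Data.List.Relation.Binary.Sublist.Heterogeneous.Properties
  using (length-mono-≤; ⊆-filter-Sublist)
open import Data.List.Relation.Unary.All as All using (All; []; _∷_)
open import Data.List.Relation.Unary.All.Properties using (all-filter) renaming (map⁺ to All-map⁺)
open import Data.List.Relation.Unary.AllPairs using ([]; _∷_)
open import Data.List.Relation.Unary.Any using (here; there)
open import Data.List.Relation.Unary.Unique.Propositional using (Unique)
import Data.List.Relation.Unary.Unique.Propositional.Properties as Unique
open import Data.Nat using (ℕ; zero; suc; _*_; _^_; _≤_; _<_; _≤′_; ≤′-refl; ≤′-step; s≤s)
open import Data.Nat.Properties
  using ( *-assoc; *-monoʳ-≤; *-identityˡ; *-commutativeSemigroup; ≤⇒≤′; <⇒≱; <⇒≤; ≤-reflexive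
        ; module ≤-Reasoning)
open import Data.Product using (Σ; _×_; ∃; _,_; proj₁)
open import Data.Sum using ([_,_]; inj₁; inj₂)
open import Data.Vec using ([]; _∷_; here; there)
open import Function using (_∘_; id)
open import Relation.Binary.PropositionalEquality
  using (_≡_; _≢_; refl; sym; trans; cong; subst; module ≡-Reasoning)
open import Relation.Nullary using (yes; no; contradiction; _×-dec_)

private
  variable
    n : ℕ
    x : Fin n
    p q r : Subset n

x∈p─q⇒x∉q : x ∈ₛ p ─ q → x ∉ q
x∈p─q⇒x∉q {p = _ ∷ _} {q = inside  ∷ _} ()            here
x∈p─q⇒x∉q {p = _ ∷ _} {q = _       ∷ _} (there x∈p─q) (there x∈q) = x∈p─q⇒x∉q x∈p─q x∈q

─-monoˡ-⊆ : p ⊆ q → p ─ r ⊆ q ─ r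
─-monoˡ-⊆ p⊆q x∈p─r = x∈p∧x∉q⇒x∈p─q (p⊆q (p─q⊆p _ _ x∈p─r)) (x∈p─q⇒x∉q x∈p─r)

─-distribʳ-∪ : ∀ (p q r : Subset n) → (p ∪ q) ─ r ≡ (p ─ r) ∪ (q ─ r)
─-distribʳ-∪ []      []      []            = refl
─-distribʳ-∪ (_ ∷ p) (_ ∷ q) (inside  ∷ r) = cong (outside ∷_) (─-distribʳ-∪ p q r)
─-distribʳ-∪ (_ ∷ p) (_ ∷ q) (outside ∷ r) = cong (_ ∷_) (─-distribʳ-∪ p q r)

∪-lub : p ⊆ r → q ⊆ r → p ∪ q ⊆ r
∪-lub p⊆r q⊆r x∈p∪q = [ p⊆r , q⊆r ] (x∈p∪q⁻ _ _ x∈p∪q)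

x∈p⇒⁅x⁆⊆p : x ∈ₛ p → ⁅ x ⁆ ⊆ p
x∈p⇒⁅x⁆⊆p {x = x} x∈p y∈⁅x⁆ = subst (_∈ₛ _) (sym (x∈⁅y⁆⇒x≡y x y∈⁅x⁆)) x∈p

q⊆p⇒[p─q]∪q≡p : q ⊆ p → (p ─ q) ∪ q ≡ p
q⊆p⇒[p─q]∪q≡p {q = q} {p = p} q⊆p = ⊆-antisym (∪-lub (p─q⊆p p q) q⊆p) p⊆[p─q]∪q
  where
  p⊆[p─q]∪q : p ⊆ (p ─ q) ∪ q
  p⊆[p─q]∪q {x} x∈p with x ∈? q
  ... | yes x∈q = q⊆p∪q (p ─ q) q x∈q
  ... | no  x∉q = p⊆p∪q q (x∈p∧x∉q⇒x∈p─q x∈p x∉q)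

─-cancelʳ : r ⊆ p → r ⊆ q → p ─ r ≡ q ─ r → p ≡ q
─-cancelʳ {r = r} {p = p} {q = q} r⊆p r⊆q eq = begin
  p             ≡⟨ q⊆p⇒[p─q]∪q≡p r⊆p ⟨
  (p ─ r) ∪ r   ≡⟨ cong (_∪ r) eq ⟩
  (q ─ r) ∪ r   ≡⟨ q⊆p⇒[p─q]∪q≡p r⊆q ⟩
  q             ∎
  where open ≡-Reasoning

x∉p⇒∣p∪⁅x⁆∣≡1+∣p∣ : x ∉ p → ∣ p ∪ ⁅ x ⁆ ∣ ≡ suc ∣ p ∣
x∉p⇒∣p∪⁅x⁆∣≡1+∣p∣ {x = Fin.zero}  {p = inside  ∷ p} x∉p = contradiction here x∉p
x∉p⇒∣p∪⁅x⁆∣≡1+∣p∣ {x = Fin.zero}  {p = outside ∷ p} x∉p = cong (suc ∘ ∣_∣) (∪-identityʳ p)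
x∉p⇒∣p∪⁅x⁆∣≡1+∣p∣ {x = Fin.suc x} {p = inside  ∷ p} x∉p =
  cong suc (x∉p⇒∣p∪⁅x⁆∣≡1+∣p∣ (x∉p ∘ there))
x∉p⇒∣p∪⁅x⁆∣≡1+∣p∣ {x = Fin.suc x} {p = outside ∷ p} x∉p = x∉p⇒∣p∪⁅x⁆∣≡1+∣p∣ (x∉p ∘ there)

x∈⋃⁻ : ∀ (Ps : List (Subset n)) → x ∈ₛ ⋃ Ps → ∃ λ P → P ∈ Ps × x ∈ₛ P
x∈⋃⁻ []       x∈⋃ = contradiction x∈⋃ ∉⊥
x∈⋃⁻ (P ∷ Ps) x∈⋃ with x∈p∪q⁻ P (⋃ Ps) x∈⋃
... | inj₁ x∈P = P , here refl , x∈P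
... | inj₂ x∈⋃Ps with x∈⋃⁻ Ps x∈⋃Ps
...   | Q , Q∈Ps , x∈Q = Q , there Q∈Ps , x∈Q

⊆⋃ : ∀ (Ps : List (Subset n)) → p ∈ Ps → p ⊆ ⋃ Ps
⊆⋃ (P ∷ Ps) (here refl) = p⊆p∪q (⋃ Ps)
⊆⋃ (P ∷ Ps) (there p∈Ps) = ⊆-trans (⊆⋃ Ps p∈Ps) (q⊆p∪q P (⋃ Ps))

⋃-closed : ∀ {Qs : List (Subset n)} → (∀ {p q} → p ∈ Qs → q ∈ Qs → p ∪ q ∈ Qs) →
           ∀ {Ps} → Ps ≢ [] → All (_∈ Qs) Ps → ⋃ Ps ∈ Qs
⋃-closed closed {[]}         Ps≢[] _          = contradiction refl Ps≢[]
⋃-closed closed {P ∷ []}     _     (P∈ ∷ [])  = subst (_∈ _) (sym (∪-identityʳ P)) P∈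
⋃-closed closed {P ∷ Q ∷ Ps} _     (P∈ ∷ Ps∈) = closed P∈ (⋃-closed closed (λ ()) Ps∈)

map⁺-injectiveOn : ∀ {A B : Set} {P : A → Set} {f : A → B} →
                   (∀ {a b} → P a → P b → f a ≡ f b → a ≡ b) →
                   ∀ {as} → All P as → Unique as → Unique (map f as)
map⁺-injectiveOn inj []         []           = []
map⁺-injectiveOn inj (Pa ∷ Pas) (a∉as ∷ uas) =
  All-map⁺ (All.zipWith (λ (Pb , a≢b) fa≡fb → a≢b (inj Pa Pb fa≡fb)) (Pas , a∉as))
  ∷ map⁺-injectiveOn inj Pas uas

∣p∣<∣q∣⇒Nonempty[q─p] : ∣ p ∣ < ∣ q ∣ → Nonempty (q ─ p)
∣p∣<∣q∣⇒Nonempty[q─p] {p = p} {q = q} ∣p∣<∣q∣ with nonempty? (q ─ p)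
... | yes q─p≢∅ = q─p≢∅
... | no  q─p≡∅ = contradiction (p⊆q⇒∣p∣≤∣q∣ q⊆p) (<⇒≱ ∣p∣<∣q∣)
  where
  q⊆p : q ⊆ p
  q⊆p {x} x∈q with x ∈? p
  ... | yes x∈p = x∈p
  ... | no  x∉p = contradiction (x , x∈p∧x∉q⇒x∈p─q x∈q x∉p) q─p≡∅

nonempty-member⇒Nontrivial : ∀ {𝓖 : Family n} → Nonempty p → p ∈ members 𝓖 → Nontrivial 𝓖
nonempty-member⇒Nontrivial {p = p} {𝓖 = 𝓖} (x , x∈p) p∈𝓖 = 𝓖≢[] , 𝓖≢[⊥]
  where
  𝓖≢[] : members 𝓖 ≢ []
  𝓖≢[] eq with subst (p ∈_) eq p∈𝓖
  ... | ()
  𝓖≢[⊥] : members 𝓖 ≢ ⊥ ∷ []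
  𝓖≢[⊥] eq with subst (p ∈_) eq p∈𝓖
  ... | here refl = ∉⊥ x∈p

U∈members : ∀ (𝓕 : Family n) → UnionClosed 𝓕 → members 𝓕 ≢ [] → U 𝓕 ∈ members 𝓕
U∈members 𝓕 uc 𝓕≢∅ = ⋃-closed (uc _ _) 𝓕≢∅ (All.tabulate id)

containing-⊥ : ∀ (𝓕 : Family n) → containing 𝓕 ⊥ ≡ ∣ 𝓕 ∣ᶠ
containing-⊥ 𝓕 = cong length (filter-all (⊥ ⊆?_) {members 𝓕} (All.tabulate (λ {F} _ → ⊆-min F)))

link : Family n → Subset n → Family n
link 𝓕 S = family (map (_─ S) (filter (S ⊆?_) (members 𝓕)))
  (map⁺-injectiveOn ─-cancelʳ (all-filter (S ⊆?_) (members 𝓕)) (Unique.filter⁺ (S ⊆?_) (unique 𝓕)))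

module _ (𝓕 : Family n) (S : Subset n) where

  LinkOf : Subset n → Subset n → Set
  LinkOf A F = S ⊆ F × A ≡ F ─ S

  ∣link∣≡containing : ∣ link 𝓕 S ∣ᶠ ≡ containing 𝓕 S
  ∣link∣≡containing = length-map (_─ S) (filter (S ⊆?_) (members 𝓕))

  ∈-link⁺ : ∀ {F} → F ∈ members 𝓕 → S ⊆ F → F ─ S ∈ members (link 𝓕 S)
  ∈-link⁺ F∈𝓕 S⊆F = ∈-map⁺ (_─ S) (∈-filter⁺ (S ⊆?_) F∈𝓕 S⊆F)

  ∈-link⁻ : ∀ {A} → A ∈ members (link 𝓕 S) → ∃ λ F → F ∈ members 𝓕 × S ⊆ F × A ≡ F ─ S
  ∈-link⁻ A∈ with ∈-map⁻ (_─ S) A∈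
  ... | F , F∈ , refl with ∈-filter⁻ (S ⊆?_) F∈
  ...   | F∈𝓕 , S⊆F = F , F∈𝓕 , S⊆F , refl

  link-unionClosed : UnionClosed 𝓕 → UnionClosed (link 𝓕 S)
  link-unionClosed uc A B A∈ B∈ with ∈-link⁻ A∈ | ∈-link⁻ B∈
  ... | F , F∈𝓕 , S⊆F , refl | G , G∈𝓕 , S⊆G , refl =
    subst (_∈ members (link 𝓕 S)) (─-distribʳ-∪ F G S)
      (∈-link⁺ (uc F G F∈𝓕 G∈𝓕) (⊆-trans S⊆F (p⊆p∪q G)))

  U-link⊆U─S : U (link 𝓕 S) ⊆ U 𝓕 ─ S
  U-link⊆U─S x∈U with x∈⋃⁻ (members (link 𝓕 S)) x∈U
  ... | A , A∈ , x∈A with ∈-link⁻ A∈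
  ...   | F , F∈𝓕 , _ , refl = ─-monoˡ-⊆ (⊆⋃ (members 𝓕) F∈𝓕) x∈A

  link-nontrivial : UnionClosed 𝓕 → S ⊆ U 𝓕 → Nonempty (U 𝓕 ─ S) → Nontrivial (link 𝓕 S)
  link-nontrivial uc S⊆U U─S≢∅@(y , y∈U─S) =
    nonempty-member⇒Nontrivial {𝓖 = link 𝓕 S} U─S≢∅ (∈-link⁺ (U∈members 𝓕 uc 𝓕≢∅) S⊆U)
    where
    𝓕≢∅ : members 𝓕 ≢ []
    𝓕≢∅ eq = ∉⊥ (subst (λ Fs → y ∈ₛ ⋃ Fs) eq (p─q⊆p _ S y∈U─S))

  link-Sublist : Sublist LinkOf (members (link 𝓕 S)) (members 𝓕)
  link-Sublist = go (members 𝓕)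
    where
    go : ∀ Fs → Sublist LinkOf (map (_─ S) (filter (S ⊆?_) Fs)) Fs
    go []       = []
    go (F ∷ Fs) with S ⊆? F
    ... | yes S⊆F = (S⊆F , refl) ∷ go Fs
    ... | no  _   = F ∷ʳ go Fs

  ∣link-at∣≤containing : ∀ x → ∣ link 𝓕 S at x ∣ ≤ containing 𝓕 (S ∪ ⁅ x ⁆)
  ∣link-at∣≤containing x = length-mono-≤ (⊆-filter-Sublist (x ∈?_) ((S ∪ ⁅ x ⁆) ⊆?_)
    S∪⁅x⁆⊆F link-Sublist)
    where
    S∪⁅x⁆⊆F : ∀ {A F} → LinkOf A F → x ∈ₛ A → S ∪ ⁅ x ⁆ ⊆ F
    S∪⁅x⁆⊆F (S⊆F , refl) x∈F─S = ∪-lub S⊆F (x∈p⇒⁅x⁆⊆p (p─q⊆p _ S x∈F─S))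

frankl-step : FranklConjecture → ∀ (𝓕 : Family n) {S} → UnionClosed 𝓕 → S ⊆ U 𝓕 →
              Nonempty (U 𝓕 ─ S) →
              ∃ λ x → x ∈ₛ U 𝓕 ─ S × containing 𝓕 S ≤ 2 * containing 𝓕 (S ∪ ⁅ x ⁆)
frankl-step frankl 𝓕 {S} uc S⊆U U─S≢∅
  with frankl _ (link 𝓕 S) (link-unionClosed 𝓕 S uc) (link-nontrivial 𝓕 S uc S⊆U U─S≢∅)
... | x , x∈U-link , half = x , U-link⊆U─S 𝓕 S x∈U-link , (begin
  containing 𝓕 S                ≡⟨ ∣link∣≡containing 𝓕 S ⟨
  ∣ link 𝓕 S ∣ᶠ                 ≤⟨ half ⟩
  2 * ∣ link 𝓕 S at x ∣         ≤⟨ *-monoʳ-≤ 2 (∣link-at∣≤containing 𝓕 S x) ⟩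
  2 * containing 𝓕 (S ∪ ⁅ x ⁆) ∎)
  where open ≤-Reasoning

module FranklChain (frankl : FranklConjecture) (𝓕 : Family n) (uc : UnionClosed 𝓕) where

  Popular : ℕ → Subset n → Set
  Popular k S = S ⊆ U 𝓕 × ∣ S ∣ ≡ k × ∣ 𝓕 ∣ᶠ ≤ 2 ^ k * containing 𝓕 S

  -- Past k = ∣ U 𝓕 ∣ the chain stays constant (junk values, never used).
  next : Subset n → Subset n
  next S with S ⊆? U 𝓕 ×-dec nonempty? (U 𝓕 ─ S)
  ... | yes (S⊆U , U─S≢∅) = S ∪ ⁅ proj₁ (frankl-step frankl 𝓕 uc S⊆U U─S≢∅) ⁆
  ... | no  _             = S

  chain : ℕ → Subset n
  chain zero    = ⊥
  chain (suc k) = next (chain k)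

  ⊆-next : ∀ S → S ⊆ next S
  ⊆-next S with S ⊆? U 𝓕 ×-dec nonempty? (U 𝓕 ─ S)
  ... | yes _ = p⊆p∪q _
  ... | no  _ = ⊆-refl

  next-step : ∀ {S} → S ⊆ U 𝓕 → Nonempty (U 𝓕 ─ S) →
              ∃ λ x → next S ≡ S ∪ ⁅ x ⁆ × x ∈ₛ U 𝓕 ─ S
                    × containing 𝓕 S ≤ 2 * containing 𝓕 (S ∪ ⁅ x ⁆)
  next-step {S} S⊆U U─S≢∅ with S ⊆? U 𝓕 ×-dec nonempty? (U 𝓕 ─ S)
  ... | yes (S⊆U′ , U─S≢∅′) =
    let x , properties = frankl-step frankl 𝓕 uc S⊆U′ U─S≢∅′ in x , refl , properties
  ... | no  ¬both           = contradiction ((λ {_} → S⊆U) , U─S≢∅) ¬both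

  chain-mono : ∀ {i j} → i ≤ j → chain i ⊆ chain j
  chain-mono = go ∘ ≤⇒≤′
    where
    go : ∀ {i j} → i ≤′ j → chain i ⊆ chain j
    go ≤′-refl        = ⊆-refl
    go (≤′-step i≤′j) = ⊆-trans (go i≤′j) (⊆-next _)

  popular-next : ∀ {k S} → k < ∣ U 𝓕 ∣ → Popular k S → Popular (suc k) (next S)
  popular-next {k} {S} k<∣U∣ (S⊆U , refl , bound)
    with next-step S⊆U (∣p∣<∣q∣⇒Nonempty[q─p] k<∣U∣)
  ... | x , eq , x∈U─S , halving rewrite eq =
      ∪-lub S⊆U (x∈p⇒⁅x⁆⊆p (p─q⊆p _ S x∈U─S))
    , x∉p⇒∣p∪⁅x⁆∣≡1+∣p∣ (x∈p─q⇒x∉q x∈U─S)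
    , (begin
      ∣ 𝓕 ∣ᶠ                 ≤⟨ bound ⟩
      2 ^ k * containing 𝓕 S ≤⟨ *-monoʳ-≤ (2 ^ k) halving ⟩
      2 ^ k * (2 * c)        ≡⟨ x∙yz≈y∙xz *-commutativeSemigroup (2 ^ k) 2 c ⟩
      2 * (2 ^ k * c)        ≡⟨ *-assoc 2 (2 ^ k) c ⟨
      2 ^ suc k * c          ∎)
    where
    open ≤-Reasoning
    c = containing 𝓕 (S ∪ ⁅ x ⁆)

  popular-chain : ∀ {k} → k ≤ ∣ U 𝓕 ∣ → Popular k (chain k)
  popular-chain {zero}  _     =
    ⊆-min _ , ∣⊥∣≡0 n , ≤-reflexive (sym (trans (*-identityˡ _) (containing-⊥ 𝓕)))
  popular-chain {suc k} k<∣U∣ = popular-next k<∣U∣ (popular-chain (<⇒≤ k<∣U∣))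

proposition2p8 : FranklConjecture → ∀ (m : ℕ) (𝓕 : Family m) → UnionClosed 𝓕 →
    (Σ (Fin ∣ U 𝓕 ∣ → Subset m) λ S →
        (∀ (i j : Fin ∣ U 𝓕 ∣) → toℕ i ≤ toℕ j → S i ⊆ S j)
      × (∀ (i : Fin ∣ U 𝓕 ∣) → S i ⊆ U 𝓕
           × ∣ S i ∣ ≡ suc (toℕ i)
           × ∣ 𝓕 ∣ᶠ ≤ 2 ^ suc (toℕ i) * containing 𝓕 (S i)))
  × (∀ (k : ℕ) → 1 ≤ k → k ≤ ∣ U 𝓕 ∣ →
        ∃ λ (S : Subset m) → S ⊆ U 𝓕 × ∣ S ∣ ≡ k × ∣ 𝓕 ∣ᶠ ≤ 2 ^ k * containing 𝓕 S)
proposition2p8 frankl m 𝓕 uc =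
    ( (λ i → chain (suc (toℕ i)))
    , (λ i j i≤j → chain-mono (s≤s i≤j))
    , (λ i → popular-chain (toℕ<n i)) )
  , (λ k _ k≤∣U∣ → chain k , popular-chain k≤∣U∣)
  where open FranklChain frankl 𝓕 uc
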